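{- Let $f\in V_3$. Then $s_{ -1,1}(f)=w^{ -9}f(w^{10})$, $s_{1,0}(f)=w^{ -3}f(w^{10})$, $s_{0,1}(f)=w^{ -7}f(w^{10})$, and $s_{1,1}(f)=w^{ -1}f(w^{10})$.
   Context: Let $g:\mathbb{N}\to\mathbb{N}$ be given by $g(0)=0$, $g(2n)=4g(n)$, $g(2n+1)=g(2n)+1$, and $[a,b]=t^{1+2g(a)+4g(b)}$ for $a,b\in\mathbb{N}$. Let $V=t\,\mathbb{Z}/2[t^2]$, $V'\subset\mathbb{Z}/2[w]$ spanned by the $w^k$ with $k\equiv1,3,7,9\pmod{20}$, and $\varphi:V\to V'$ the $\mathbb{Z}/2$-linear map with $\varphi(t),\varphi(t^3),\varphi(t^5),\varphi(t^9)=w,w^3,w^7,w^9$; $\varphi(t^7),\varphi(t^{11}),\varphi(t^{13}),\varphi(t^{15})=w^{21},w^{27},w^{23},w^{29}$; $\varphi(t^{16}f)=w^{40}\varphi(f)$. Put $\langle a,b\rangle=\varphi([a,b])$. $V_3\subset V$ is the span of the $t^n$ with $n\equiv3\pmod4$ (equivalently of the $[c,d]$ with $c$ odd). For $i,j\ge0$, $s_{i,j}:V\to V'$ is the $\mathbb{Z}/2$-linear map with $s_{i,j}([c,d])=\langle 2c+i,2d+j\rangle$, and $s_{ -1,1}:V_3\to V'$ is the $\mathbb{Z}/2$-linear map with $s_{ -1,1}([c,d])=\langle 2c-1,2d+1\rangle$ for $c$ odd. -}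

module Defs where

open import Data.Nat using (ℕ; zero; suc; _+_; _*_; _∸_; _≡ᵇ_)
open import Data.Nat.DivMod using (_/_; _%_)
open import Data.Bool using (Bool; true; false; _xor_)
open import Data.List using (List; []; _∷_; map; foldr)
open import Data.Product using (_×_; _,_; proj₁; proj₂)
open import Relation.Binary.PropositionalEquality using (_≡_)

-- Polynomials over ℤ/2.
-- A polynomial is represented by a finite list of exponents; the
-- coefficient of x^k is the parity of the number of occurrences of k.

Poly : Set
Poly = List ℕ

coeff : Poly → ℕ → Bool
coeff p k = foldr (λ e acc → (e ≡ᵇ k) xor acc) false p

infix 4 _≈_
_≈_ : Poly → Poly → Set
p ≈ q = ∀ k → coeff p k ≡ coeff q k

-- f ∈ V = t ℤ/2[t²] : only odd exponents occur
InV : Poly → Set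
InV f = ∀ k → coeff f k ≡ true → k % 2 ≡ 1

InV₃ : Poly → Set
InV₃ f = ∀ k → coeff f k ≡ true → k % 4 ≡ 3

-- g(0)=0, g(2n)=4g(n), g(2n+1)=g(2n)+1   (fuel-based recursion; fuel n suffices)

gF : ℕ → ℕ → ℕ
gF zero    n = 0
gF (suc k) n = 4 * gF k (n / 2) + n % 2

g : ℕ → ℕ
g n = gF n n

-- exponent of [a,b] = t^(1 + 2g(a) + 4g(b))
brExp : ℕ → ℕ → ℕ
brExp a b = 1 + 2 * g a + 4 * g b

-- Inverse: for odd n, n = brExp a b with (a , b) = unbr n.
-- (n-1)/2 = g(a) + 2 g(b): a collects the even-position bits, b the odd ones.
unweave : ℕ → ℕ → ℕ × ℕ
unweave zero    m = 0 , 0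
unweave (suc k) m =
  m % 2 + 2 * proj₁ (unweave k (m / 4)) , (m / 2) % 2 + 2 * proj₂ (unweave k (m / 4))

unbr : ℕ → ℕ × ℕ
unbr n = unweave (n / 2) (n / 2)

-- φ : V → V' on monomials:  φ(t^(16q+r)) = w^(40q) φ(t^r)

φtab : ℕ → ℕ
φtab 1  = 1
φtab 3  = 3
φtab 5  = 7
φtab 9  = 9
φtab 7  = 21
φtab 11 = 27
φtab 13 = 23
φtab 15 = 29
φtab _  = 0   -- even residues: never used on V

φExp : ℕ → ℕ
φExp n = 40 * (n / 16) + φtab (n % 16)

-- ⟨a,b⟩ = φ([a,b]) is the monomial w^(angExp a b)
angExp : ℕ → ℕ → ℕ
angExp a b = φExp (brExp a b)

-- The linear maps s_{i,j} (i,j ≥ 0) and s_{-1,1}, extended ℤ/2-linearly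
-- from the basis [c,d] (each basis vector goes to a monomial).

sExp : ℕ → ℕ → ℕ → ℕ
sExp i j n = angExp (2 * proj₁ (unbr n) + i) (2 * proj₂ (unbr n) + j)

s : ℕ → ℕ → Poly → Poly
s i j f = map (sExp i j) f

-- s_{-1,1}([c,d]) = ⟨2c-1, 2d+1⟩  (c odd, so 2c-1 ≥ 1)
sm1Exp : ℕ → ℕ
sm1Exp n = angExp (2 * proj₁ (unbr n) ∸ 1) (2 * proj₂ (unbr n) + 1)

s₋₁₁ : Poly → Poly
s₋₁₁ f = map sm1Exp f

-- w^(-e) f(w^10) : the monomial t^n goes to w^(10n - e)
-- (for f ∈ V₃ all exponents are ≥ 3, so 10n - e ≥ 21 > 0 for e ≤ 9)

subst10 : ℕ → Poly → Poly
subst10 e f = map (λ n → 10 * n ∸ e) f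

module Submission where

-- All five maps in the statement (s₋₁₁, s i j, subst10 e) act
-- on a polynomial by sending each monomial t^n to a single monomial
-- w^(h n).  Hence the theorem reduces to two independent facts:
--
--   (1) Over ℤ/2, two such "monomial maps" h, h' give the same polynomial
--       on f as soon as h and h' agree on the exponents that actually occur
--       in f (an exponent listed an even number of times cancels out on
--       both sides).
--   (2) For every n ≡ 3 (mod 4) the exponent identities
--       sExp 1 0 n = 10n-3, sExp 0 1 n = 10n-7, sExp 1 1 n = 10n-1 and
--       sm1Exp n = 10n-9 hold.  Writing n = 4q+3 and [c,d] = t^n, we get
--       g c + 2 g d = (n-1)/2 = 2q+1 with c odd; doubling the arguments
--       multiplies g by 4 and appends a binary digit, so [2c+i,2d+j] is
--       t^(16q+9+2i+4j), and φ sends it to w^(40q+φ(t^(9+2i+4j))).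

open import Defs
open import Data.Product using (_×_; _,_; proj₁; proj₂; ∃)
open import Function using (_∘_)
open import Relation.Nullary using (yes; no; contradiction)
open import Data.Nat using (ℕ; zero; suc; _+_; _*_; _∸_; _≡ᵇ_; _≤_; _<_; z≤n; s≤s; NonZero)
open import Data.Nat.Properties
open import Data.Nat.DivMod
open import Data.Nat.Divisibility using (n∣m*n)
open import Data.Bool using (Bool; true; false; _xor_; T)
open import Data.Bool.Properties using (xor-same; xor-∧-commutativeRing)
open import Algebra.Bundles using (CommutativeRing)
open import Algebra.Properties.CommutativeSemigroup
  (CommutativeRing.+-commutativeSemigroup xor-∧-commutativeRing)
  using () renaming (interchange to xor-interchange)
open import Data.List using ([]; _∷_; map; foldr)
open import Data.List.Properties using (foldr-map)
open import Relation.Binary.PropositionalEquality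
open import Data.Nat.Tactic.RingSolver using (solve-∀)

-- The ℤ/2-sum of a Boolean function over the exponents listed in l.
-- The coefficient function is the special case F = (_≡ᵇ k), definitionally.
xorSum : (ℕ → Bool) → Poly → Bool
xorSum F l = foldr (λ e acc → F e xor acc) false l

xorSum-xor : ∀ F G l → xorSum (λ x → F x xor G x) l ≡ xorSum F l xor xorSum G l
xorSum-xor F G []      = refl
xorSum-xor F G (e ∷ l) = begin
  (F e xor G e) xor xorSum (λ x → F x xor G x) l
    ≡⟨ cong ((F e xor G e) xor_) (xorSum-xor F G l) ⟩
  (F e xor G e) xor (xorSum F l xor xorSum G l)
    ≡⟨ xor-interchange (F e) (G e) (xorSum F l) (xorSum G l) ⟩
  (F e xor xorSum F l) xor (G e xor xorSum G l) ∎
  where open ≡-Reasoning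

xor≡false⇒≡ : ∀ a b → a xor b ≡ false → a ≡ b
xor≡false⇒≡ false b eq = sym eq
xor≡false⇒≡ true false ()
xor≡false⇒≡ true true _ = refl

≡ᵇ-refl : ∀ n → (n ≡ᵇ n) ≡ true
≡ᵇ-refl zero    = refl
≡ᵇ-refl (suc n) = ≡ᵇ-refl n

≢⇒≡ᵇ-false : ∀ {m n} → m ≢ n → (m ≡ᵇ n) ≡ false
≢⇒≡ᵇ-false {m} {n} m≢n with m ≡ᵇ n in m≡ᵇn
... | false = refl
... | true  = contradiction (≡ᵇ⇒≡ m n (subst T (sym m≡ᵇn) _)) m≢n

coeff-∷-other : ∀ {e x} l → e ≢ x → coeff (e ∷ l) x ≡ coeff l x
coeff-∷-other {x = x} l e≢x = cong (_xor coeff l x) (≢⇒≡ᵇ-false e≢x)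

-- Induction on l, generalised over the summand: when the head
-- e is not in the support of e ∷ l it must occur in l, and toggling the
-- summand at e moves the value D e into the tail sum.
xorSum-offSupport : ∀ l (D : ℕ → Bool) →
  (∀ x → D x ≡ true → coeff l x ≡ false) → xorSum D l ≡ false
xorSum-offSupport []      D vanish = refl
xorSum-offSupport (e ∷ l) D vanish with D e in De
... | false = xorSum-offSupport l D tailVanish
  where
  tailVanish : ∀ x → D x ≡ true → coeff l x ≡ false
  tailVanish x Dx with e ≟ x
  ... | yes refl = contradiction (trans (sym De) Dx) λ ()
  ... | no e≢x   = trans (sym (coeff-∷-other l e≢x)) (vanish x Dx)
... | true = trans (sym tailSum) (xorSum-offSupport l D′ tailVanish)
  where
  D′ : ℕ → Bool
  D′ x = (x ≡ᵇ e) xor D x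

  e∈tail : coeff l e ≡ true
  e∈tail = sym (xor≡false⇒≡ true (coeff l e)
             (subst (λ b → b xor coeff l e ≡ false) (≡ᵇ-refl e) (vanish e De)))

  tailSum : xorSum D′ l ≡ true xor xorSum D l
  tailSum = trans (xorSum-xor (_≡ᵇ e) D l) (cong (_xor xorSum D l) e∈tail)

  tailVanish : ∀ x → D′ x ≡ true → coeff l x ≡ false
  tailVanish x D′x with e ≟ x
  ... | yes refl = contradiction (trans (sym (cong₂ _xor_ (≡ᵇ-refl e) De)) D′x) λ ()
  ... | no e≢x   = trans (sym (coeff-∷-other l e≢x)) (vanish x D′x≡Dx)
    where D′x≡Dx : D x ≡ true
          D′x≡Dx = trans (sym (cong (_xor D x) (≢⇒≡ᵇ-false (e≢x ∘ sym)))) D′x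

map-cong-support : ∀ (h h′ : ℕ → ℕ) f →
  (∀ e → coeff f e ≡ true → h e ≡ h′ e) → map h f ≈ map h′ f
map-cong-support h h′ f agree k = begin
  coeff (map h f) k                    ≡⟨ foldr-map _ h false f ⟩
  xorSum (λ e → h e ≡ᵇ k) f            ≡⟨ xor≡false⇒≡ _ _ sumsCancel ⟩
  xorSum (λ e → h′ e ≡ᵇ k) f           ≡⟨ sym (foldr-map _ h′ false f) ⟩
  coeff (map h′ f) k                   ∎
  where
  open ≡-Reasoning
  D : ℕ → Bool
  D e = (h e ≡ᵇ k) xor (h′ e ≡ᵇ k)

  vanish : ∀ e → D e ≡ true → coeff f e ≡ false
  vanish e De with coeff f e in fe
  ... | false = refl
  ... | true = contradiction (trans (sym Dfalse) De) λ ()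
    where Dfalse : D e ≡ false
          Dfalse = trans (cong (λ y → (y ≡ᵇ k) xor (h′ e ≡ᵇ k)) (agree e fe))
                         (xor-same (h′ e ≡ᵇ k))

  sumsCancel : xorSum (λ e → h e ≡ᵇ k) f xor xorSum (λ e → h′ e ≡ᵇ k) f ≡ false
  sumsCancel = trans (sym (xorSum-xor (λ e → h e ≡ᵇ k) (λ e → h′ e ≡ᵇ k) f))
                     (xorSum-offSupport f D vanish)

div-digit : ∀ r k d .{{_ : NonZero d}} → r < d → (r + k * d) / d ≡ k
div-digit r k d r<d = begin
  (r + k * d) / d    ≡⟨ +-distrib-/-∣ʳ r (n∣m*n k) ⟩
  r / d + k * d / d  ≡⟨ cong₂ _+_ (m<n⇒m/n≡0 r<d) (m*n/n≡m k d) ⟩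
  k                  ∎
  where open ≡-Reasoning

mod-digit : ∀ r k d .{{_ : NonZero d}} → r < d → (r + k * d) % d ≡ r
mod-digit r k d r<d = trans ([m+kn]%n≡m%n r k d) (m<n⇒m%n≡m r<d)

gF-zero : ∀ k → gF k 0 ≡ 0
gF-zero zero    = refl
gF-zero (suc k) = cong (λ x → 4 * x + 0) (gF-zero k)

gF-fuel : ∀ k k′ n → n ≤ k → n ≤ k′ → gF k n ≡ gF k′ n
gF-fuel k k′ zero _ _ = trans (gF-zero k) (sym (gF-zero k′))
gF-fuel (suc k) (suc k′) (suc n) (s≤s n≤k) (s≤s n≤k′) =
  cong (λ x → 4 * x + suc n % 2)
       (gF-fuel k k′ (suc n / 2) (≤-trans half≤n n≤k) (≤-trans half≤n n≤k′))
  where half≤n : suc n / 2 ≤ n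
        half≤n = ≤-pred (m/n<m (suc n) 2 (s≤s (s≤s z≤n)))

g-unfold : ∀ n → g n ≡ 4 * g (n / 2) + n % 2
g-unfold n = trans (gF-fuel n (suc n) n ≤-refl (n≤1+n n))
  (cong (λ x → 4 * x + n % 2) (gF-fuel n (n / 2) (n / 2) (m/n≤m n 2) ≤-refl))

g-digit : ∀ x r → r < 2 → g (2 * x + r) ≡ 4 * g x + r
g-digit x r r<2 = begin
  g (2 * x + r)                        ≡⟨ g-unfold (2 * x + r) ⟩
  4 * g ((2 * x + r) / 2) + (2 * x + r) % 2
    ≡⟨ cong₂ (λ a b → 4 * g (a / 2) + b % 2) rx2 rx2 ⟩
  4 * g ((r + x * 2) / 2) + (r + x * 2) % 2
    ≡⟨ cong₂ (λ a b → 4 * g a + b) (div-digit r x 2 r<2) (mod-digit r x 2 r<2) ⟩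
  4 * g x + r                          ∎
  where
  open ≡-Reasoning
  rx2 : 2 * x + r ≡ r + x * 2
  rx2 = trans (+-comm (2 * x) r) (cong (r +_) (*-comm 2 x))

brExp-digits : ∀ a b i j → i < 2 → j < 2 →
  brExp (2 * a + i) (2 * b + j) ≡ 1 + 2 * i + 4 * j + (g a + 2 * g b) * 8
brExp-digits a b i j i<2 j<2 = begin
  1 + 2 * g (2 * a + i) + 4 * g (2 * b + j)
    ≡⟨ cong₂ (λ x y → 1 + 2 * x + 4 * y) (g-digit a i i<2) (g-digit b j j<2) ⟩
  1 + 2 * (4 * g a + i) + 4 * (4 * g b + j)
    ≡⟨ regroup (g a) (g b) i j ⟩
  1 + 2 * i + 4 * j + (g a + 2 * g b) * 8 ∎
  where
  open ≡-Reasoning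
  regroup : ∀ x y i j →
    1 + 2 * (4 * x + i) + 4 * (4 * y + j) ≡ 1 + 2 * i + 4 * j + (x + 2 * y) * 8
  regroup = solve-∀

m≡binary-digits : ∀ m → m ≡ m % 2 + 2 * ((m / 2) % 2) + 4 * (m / 4)
m≡binary-digits m = begin
  m                                             ≡⟨ m≡m%n+[m/n]*n m 2 ⟩
  m % 2 + (m / 2) * 2
    ≡⟨ cong (λ x → m % 2 + x * 2) (m≡m%n+[m/n]*n (m / 2) 2) ⟩
  m % 2 + ((m / 2) % 2 + (m / 2 / 2) * 2) * 2
    ≡⟨ cong (λ x → m % 2 + ((m / 2) % 2 + x * 2) * 2) (m/n/o≡m/[n*o] m 2 2) ⟩
  m % 2 + ((m / 2) % 2 + (m / 4) * 2) * 2      ≡⟨ regroup (m % 2) ((m / 2) % 2) (m / 4) ⟩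
  m % 2 + 2 * ((m / 2) % 2) + 4 * (m / 4)     ∎
  where
  open ≡-Reasoning
  regroup : ∀ a b c → a + (b + c * 2) * 2 ≡ a + 2 * b + 4 * c
  regroup = solve-∀

unweave-weaves : ∀ k m → m ≤ k →
  g (proj₁ (unweave k m)) + 2 * g (proj₂ (unweave k m)) ≡ m
unweave-weaves zero    .zero z≤n = refl
unweave-weaves (suc k) m m≤k = begin
  g (m % 2 + 2 * A) + 2 * g ((m / 2) % 2 + 2 * B)
    ≡⟨ cong₂ (λ x y → g x + 2 * g y) (+-comm (m % 2) _) (+-comm ((m / 2) % 2) _) ⟩
  g (2 * A + m % 2) + 2 * g (2 * B + (m / 2) % 2)
    ≡⟨ cong₂ (λ x y → x + 2 * y) (g-digit A (m % 2) (m%n<n m 2))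
                                  (g-digit B ((m / 2) % 2) (m%n<n (m / 2) 2)) ⟩
  4 * g A + m % 2 + 2 * (4 * g B + (m / 2) % 2)  ≡⟨ regroup (g A) (g B) (m % 2) _ ⟩
  m % 2 + 2 * ((m / 2) % 2) + 4 * (g A + 2 * g B)
    ≡⟨ cong (λ x → m % 2 + 2 * ((m / 2) % 2) + 4 * x) (unweave-weaves k (m / 4) (quarter≤ m m≤k)) ⟩
  m % 2 + 2 * ((m / 2) % 2) + 4 * (m / 4)        ≡⟨ sym (m≡binary-digits m) ⟩
  m                                              ∎
  where
  open ≡-Reasoning
  A = proj₁ (unweave k (m / 4))
  B = proj₂ (unweave k (m / 4))
  regroup : ∀ x y a b → 4 * x + a + 2 * (4 * y + b) ≡ a + 2 * b + 4 * (x + 2 * y)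
  regroup = solve-∀
  quarter≤ : ∀ m → m ≤ suc k → m / 4 ≤ k
  quarter≤ zero     _      = z≤n
  quarter≤ (suc m′) bound = ≤-pred (≤-trans (m/n<m (suc m′) 4 (s≤s (s≤s z≤n))) bound)

unweave-fst-odd : ∀ m → m % 2 ≡ 1 → ∃ λ A → proj₁ (unweave m m) ≡ 2 * A + 1
unweave-fst-odd (suc j) odd = A , trans (cong (_+ 2 * A) odd) (+-comm 1 (2 * A))
  where A = proj₁ (unweave j (suc j / 4))

record V₃Monomial (n : ℕ) : Set where
  field
    q      : ℕ
    n≡     : n ≡ 3 + q * 4
    half   : ℕ
    c-odd  : proj₁ (unbr n) ≡ 2 * half + 1
    weave  : g (proj₁ (unbr n)) + 2 * g (proj₂ (unbr n)) ≡ 1 + q * 2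

v₃Monomial : ∀ n → n % 4 ≡ 3 → V₃Monomial n
v₃Monomial n n%4 = record
  { q = n / 4 ; n≡ = n≡ ; half = proj₁ c-odd ; c-odd = proj₂ c-odd
  ; weave = trans (unweave-weaves (n / 2) (n / 2) ≤-refl) n/2≡ }
  where
  n≡ : n ≡ 3 + n / 4 * 4
  n≡ = trans (m≡m%n+[m/n]*n n 4) (cong (_+ n / 4 * 4) n%4)
  regroup : ∀ q → 3 + q * 4 ≡ 1 + (1 + q * 2) * 2
  regroup = solve-∀
  n/2≡ : n / 2 ≡ 1 + n / 4 * 2
  n/2≡ = trans (cong (_/ 2) (trans n≡ (regroup (n / 4))))
               (div-digit 1 (1 + n / 4 * 2) 2 (s≤s (s≤s z≤n)))
  c-odd = unweave-fst-odd (n / 2)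
            (trans (cong (_% 2) n/2≡) (mod-digit 1 (n / 4) 2 (s≤s (s≤s z≤n))))

φExp-V₃ : ∀ r e q → r < 16 → φtab r + e ≡ 30 →
  φExp (r + q * 16) ≡ 10 * (3 + q * 4) ∸ e
φExp-V₃ r e q r<16 φr+e = begin
  40 * ((r + q * 16) / 16) + φtab ((r + q * 16) % 16)
    ≡⟨ cong₂ (λ a b → 40 * a + φtab b) (div-digit r q 16 r<16) (mod-digit r q 16 r<16) ⟩
  40 * q + φtab r                 ≡⟨ sym (m+n∸n≡m (40 * q + φtab r) e) ⟩
  40 * q + φtab r + e ∸ e         ≡⟨ cong (_∸ e) (trans (+-assoc (40 * q) _ e) (cong (40 * q +_) φr+e)) ⟩
  40 * q + 30 ∸ e                 ≡⟨ cong (_∸ e) (regroup q) ⟩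
  10 * (3 + q * 4) ∸ e            ∎
  where
  open ≡-Reasoning
  regroup : ∀ q → 40 * q + 30 ≡ 10 * (3 + q * 4)
  regroup = solve-∀

-- Fact (2) for s i j (i, j ∈ {0,1}): [2c+i, 2d+j] = t^(9+2i+4j+16q).
sExp-V₃ : ∀ i j e n → i < 2 → j < 2 → φtab (9 + 2 * i + 4 * j) + e ≡ 30 →
  n % 4 ≡ 3 → sExp i j n ≡ 10 * n ∸ e
sExp-V₃ i j e n i<2 j<2 φr+e n%4 = begin
  φExp (brExp (2 * c + i) (2 * d + j))
    ≡⟨ cong φExp (brExp-digits c d i j i<2 j<2) ⟩
  φExp (1 + 2 * i + 4 * j + (g c + 2 * g d) * 8)
    ≡⟨ cong (λ x → φExp (1 + 2 * i + 4 * j + x * 8)) weave ⟩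
  φExp (1 + 2 * i + 4 * j + (1 + q * 2) * 8)  ≡⟨ cong φExp (regroup i j q) ⟩
  φExp (9 + 2 * i + 4 * j + q * 16)           ≡⟨ φExp-V₃ _ e q digits<16 φr+e ⟩
  10 * (3 + q * 4) ∸ e                        ≡⟨ cong (λ x → 10 * x ∸ e) (sym n≡) ⟩
  10 * n ∸ e                                  ∎
  where
  open ≡-Reasoning
  open V₃Monomial (v₃Monomial n n%4)
  c = proj₁ (unbr n)
  d = proj₂ (unbr n)
  regroup : ∀ i j q → 1 + 2 * i + 4 * j + (1 + q * 2) * 8 ≡ 9 + 2 * i + 4 * j + q * 16
  regroup = solve-∀
  digits<16 : 9 + 2 * i + 4 * j < 16
  digits<16 = s≤s (+-mono-≤ (+-monoʳ-≤ 9 (*-monoʳ-≤ 2 (≤-pred i<2))) (*-monoʳ-≤ 4 (≤-pred j<2)))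

-- Fact (2) for s₋₁₁: with c = 2A+1, [2c-1, 2d+1] = [2(2A)+1, 2d+1] = t^(7+16q).
sm1Exp-V₃ : ∀ n → n % 4 ≡ 3 → sm1Exp n ≡ 10 * n ∸ 9
sm1Exp-V₃ n n%4 = begin
  φExp (brExp (2 * c ∸ 1) (2 * d + 1))
    ≡⟨ cong (λ x → φExp (brExp (2 * x ∸ 1) (2 * d + 1))) c-odd ⟩
  φExp (brExp (2 * (2 * half + 1) ∸ 1) (2 * d + 1))
    ≡⟨ cong (λ x → φExp (brExp (x ∸ 1) (2 * d + 1))) (regroup-arg half) ⟩
  φExp (brExp (2 * (2 * half) + 1) (2 * d + 1))
    ≡⟨ cong φExp (brExp-digits (2 * half) d 1 1 (s≤s (s≤s z≤n)) (s≤s (s≤s z≤n))) ⟩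
  φExp (7 + (g (2 * half) + 2 * g d) * 8)     ≡⟨ cong (λ x → φExp (7 + x * 8)) weave-even ⟩
  φExp (7 + (q * 2) * 8)                       ≡⟨ cong (λ x → φExp (7 + x)) (*-assoc q 2 8) ⟩
  φExp (7 + q * 16)                            ≡⟨ φExp-V₃ 7 9 q (<ᵇ⇒< 7 16 _) refl ⟩
  10 * (3 + q * 4) ∸ 9                         ≡⟨ cong (λ x → 10 * x ∸ 9) (sym n≡) ⟩
  10 * n ∸ 9                                   ∎
  where
  open ≡-Reasoning
  open V₃Monomial (v₃Monomial n n%4)
  c = proj₁ (unbr n)
  d = proj₂ (unbr n)
  regroup-arg : ∀ A → 2 * (2 * A + 1) ≡ 1 + (2 * (2 * A) + 1)
  regroup-arg = solve-∀
  g-c : g c ≡ suc (g (2 * half))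
  g-c = begin
    g c                         ≡⟨ cong g c-odd ⟩
    g (2 * half + 1)            ≡⟨ g-digit half 1 (s≤s (s≤s z≤n)) ⟩
    4 * g half + 1              ≡⟨ +-suc (4 * g half) 0 ⟩
    suc (4 * g half + 0)        ≡⟨ cong suc (sym (g-digit half 0 (s≤s z≤n))) ⟩
    suc (g (2 * half + 0))      ≡⟨ cong (λ x → suc (g x)) (+-identityʳ (2 * half)) ⟩
    suc (g (2 * half))          ∎
  weave-even : g (2 * half) + 2 * g d ≡ q * 2
  weave-even = suc-injective (trans (cong (_+ 2 * g d) (sym g-c)) weave)

lemma6p6 : (f : Poly) → InV₃ f →
    (s₋₁₁ f ≈ subst10 9 f) × (s 1 0 f ≈ subst10 3 f) × (s 0 1 f ≈ subst10 7 f) × (s 1 1 f ≈ subst10 1 f)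
lemma6p6 f f∈V₃ =
  map-cong-support _ _ f (λ n occurs → sm1Exp-V₃ n (f∈V₃ n occurs)) ,
  map-cong-support _ _ f (λ n occurs → sExp-V₃ 1 0 3 n 1<2 0<2 refl (f∈V₃ n occurs)) ,
  map-cong-support _ _ f (λ n occurs → sExp-V₃ 0 1 7 n 0<2 1<2 refl (f∈V₃ n occurs)) ,
  map-cong-support _ _ f (λ n occurs → sExp-V₃ 1 1 1 n 1<2 1<2 refl (f∈V₃ n occurs))
  where
  0<2 : 0 < 2
  0<2 = s≤s z≤n
  1<2 : 1 < 2
  1<2 = s≤s (s≤s z≤n)
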